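{- Let $\mathcal{R}=\mathcal{R}_0\oplus\mathcal{R}_1$ be a supercommutative ring, let $a_1,a_2,\ldots\in\mathcal{R}_0$ and $\beta_1,\beta_2,\ldots\in\mathcal{R}_1$. Define $K_0=1$, $K_1=a_1$, $L_1=\beta_1$ and, for $n\ge 2$, $$K_n=a_nK_{n-1}-K_{n-2}-\beta_nL_{n-1},\qquad L_n=\beta_nK_{n-1}+L_{n-1}.$$ For $n\ge1$ let $W_n$ be the word $(\beta_1,\beta_1,\beta_2,\beta_2,\ldots,\beta_n,\beta_n)$ of length $2n$ and $W'_n$ the word $(\beta_1,\beta_1,\ldots,\beta_{n-1},\beta_{n-1},\beta_n)$ of length $2n-1$. Then for every $n\ge 1$, $$K_n=\mathcal{E}[W_n],\qquad L_n=\mathcal{E}[W'_n],$$ where $\mathcal{E}[\cdot]$ is the sum over all admissible markings of the corresponding monomials, as defined in the context. (In words: the summands of $K_n$, resp. $L_n$, are obtained from the product $\beta_1\beta_1\beta_2\beta_2\cdots$ by striking out adjacent pairs and adjacent 4-tuples $\beta_i\beta_i\beta_{i+1}\beta_{i+1}$ in all possible ways, substituting $\beta_i\beta_i\to a_i$, $\beta_i\beta_{i+1}\to 1$, $\beta_i\beta_i\beta_{i+1}\beta_{i+1}\to -1$.)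
   Context: A supercommutative ring satisfies $xy=(-1)^{|x||y|}yx$ for homogeneous $x,y$ and $x^2=0$ for odd $x$; in particular odd elements anticommute and $\beta_i^2=0$. Rule (definition of $\mathcal{E}$): Let $w=(w_1,\ldots,w_m)$ be a word whose letters are among $\beta_1,\beta_2,\ldots$, and write $\iota(p)$ for the index of the letter at position $p$ (so $w_p=\beta_{\iota(p)}$), where in every word considered any two adjacent positions satisfy $\iota(p+1)=\iota(p)$ or $\iota(p+1)=\iota(p)+1$. An admissible marking of $w$ is a partition of $\{1,\ldots,m\}$ into blocks of consecutive positions, each block being either a singleton $\{p\}$, a pair $\{p,p+1\}$, or a quadruple $\{p,p+1,p+2,p+3\}$ with $\iota(p)=\iota(p+1)=i$ and $\iota(p+2)=\iota(p+3)=i+1$ for some $i$. The weight of a pair $\{p,p+1\}$ is $a_i$ if $\iota(p)=\iota(p+1)=i$, and $1$ if $\iota(p+1)=\iota(p)+1$; the weight of a quadruple is $-1$. The monomial of a marking is the product of the weights of all its pairs and quadruples, times the product $\beta_{\iota(p_1)}\beta_{\iota(p_2)}\cdots\beta_{\iota(p_k)}$ over its singleton positions $p_1<p_2<\cdots<p_k$ taken in increasing order. $\mathcal{E}[w]$ is the sum of the monomials of all admissible markings of $w$ (the empty word has $\mathcal{E}=1$). -}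

module Defs where

open import Level using (Level; suc; _⊔_)
open import Algebra.Bundles using (Ring)
open import Data.Nat as ℕ using (ℕ; zero) renaming (suc to 1+)
open import Data.List using (List; []; _∷_; _++_; map; foldr)
open import Data.Sum using (_⊎_; inj₁; inj₂)
open import Data.Product using (_×_; Σ; _,_)
open import Relation.Binary.PropositionalEquality using (_≡_)
open import Relation.Nullary using (yes; no)

record SuperCommutativeRing (c ℓ : Level) : Set (suc (c ⊔ ℓ)) where
  field
    ring : Ring c ℓ
  open Ring ring public
  field
    Even Odd : Carrier → Set ℓ
    Even-resp : ∀ {x y} → x ≈ y → Even x → Even y
    Odd-resp  : ∀ {x y} → x ≈ y → Odd x → Odd y
    Even-0 : Even 0#
    Even-+ : ∀ {x y} → Even x → Even y → Even (x + y)
    Even-- : ∀ {x} → Even x → Even (- x)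
    Odd-0 : Odd 0#
    Odd-+ : ∀ {x y} → Odd x → Odd y → Odd (x + y)
    Odd-- : ∀ {x} → Odd x → Odd (- x)
    decompose : ∀ x → Σ Carrier λ e → Σ Carrier λ o → Even e × Odd o × (x ≈ e + o)
    Even∩Odd : ∀ {x} → Even x → Odd x → x ≈ 0#
    Even-1 : Even 1#
    Even-*-Even : ∀ {x y} → Even x → Even y → Even (x * y)
    Even-*-Odd  : ∀ {x y} → Even x → Odd y → Odd (x * y)
    Odd-*-Even  : ∀ {x y} → Odd x → Even y → Odd (x * y)
    Odd-*-Odd   : ∀ {x y} → Odd x → Odd y → Even (x * y)
    comm-Even-Even : ∀ {x y} → Even x → Even y → x * y ≈ y * x
    comm-Even-Odd  : ∀ {x y} → Even x → Odd y → x * y ≈ y * x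
    comm-Odd-Odd   : ∀ {x y} → Odd x → Odd y → x * y ≈ - (y * x)
    square-Odd     : ∀ {x} → Odd x → x * x ≈ 0#

-- Words are lists of letter indices: the letter i stands for β_i.

W : ℕ → List ℕ
W zero = []
W (1+ n) = W n ++ (1+ n ∷ 1+ n ∷ [])

W' : ℕ → List ℕ
W' zero = []
W' (1+ n) = W n ++ (1+ n ∷ [])

-- Admissible markings of a word, read left to right as a sequence of
-- blocks: a singleton, a pair of adjacent positions (whose indices are
-- equal or increase by one), or a quadruple (i,i,i+1,i+1).
data Marking : List ℕ → Set where
  done   : Marking []
  single : ∀ {i w} → Marking w → Marking (i ∷ w)
  pair   : ∀ {i j w} → (j ≡ i ⊎ j ≡ 1+ i) → Marking w → Marking (i ∷ j ∷ w)
  quad   : ∀ {i j k l w} → j ≡ i → k ≡ 1+ i → l ≡ 1+ i → Marking w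
         → Marking (i ∷ j ∷ k ∷ l ∷ w)

-- The (complete, duplicate-free) list of all admissible markings of a word.
pairPart : ∀ i j {w} → List (Marking w) → List (Marking (i ∷ j ∷ w))
pairPart i j ms with j ℕ.≟ i
... | yes p = map (pair (inj₁ p)) ms
... | no _ with j ℕ.≟ 1+ i
...   | yes q = map (pair (inj₂ q)) ms
...   | no _  = []

quadPart : ∀ i j k l {w} → List (Marking w) → List (Marking (i ∷ j ∷ k ∷ l ∷ w))
quadPart i j k l ms with j ℕ.≟ i | k ℕ.≟ 1+ i | l ℕ.≟ 1+ i
... | yes p | yes q | yes r = map (quad p q r) ms
... | _ | _ | _ = []

markings : (w : List ℕ) → List (Marking w)
markings [] = done ∷ []
markings (i ∷ []) = map single (markings [])
markings (i ∷ j ∷ []) =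
  map single (markings (j ∷ [])) ++ pairPart i j (markings [])
markings (i ∷ j ∷ k ∷ []) =
  map single (markings (j ∷ k ∷ [])) ++ pairPart i j (markings (k ∷ []))
markings (i ∷ j ∷ k ∷ l ∷ w) =
  map single (markings (j ∷ k ∷ l ∷ w))
  ++ pairPart i j (markings (k ∷ l ∷ w))
  ++ quadPart i j k l (markings w)

module _ {c ℓ} (R : SuperCommutativeRing c ℓ)
         (a β : ℕ → SuperCommutativeRing.Carrier R) where
  open SuperCommutativeRing R

  weights : ∀ {w} → Marking w → Carrier
  weights done = 1#
  weights (single m) = weights m
  weights (pair {i = i} (inj₁ _) m) = a i * weights m
  weights (pair (inj₂ _) m) = 1# * weights m
  weights (quad _ _ _ m) = (- 1#) * weights m

  singles : ∀ {w} → Marking w → Carrier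
  singles done = 1#
  singles (single {i = i} m) = β i * singles m
  singles (pair _ m) = singles m
  singles (quad _ _ _ m) = singles m

  monomial : ∀ {w} → Marking w → Carrier
  monomial m = weights m * singles m

  𝓔 : List ℕ → Carrier
  𝓔 w = foldr _+_ 0# (map monomial (markings w))

  K : ℕ → Carrier
  L : ℕ → Carrier
  K zero = 1#
  K (1+ zero) = a 1
  K (1+ (1+ n)) = a (2 ℕ.+ n) * K (1+ n) - K n - β (2 ℕ.+ n) * L (1+ n)
  L zero = 0#   -- not used by the statement (L is only defined for n ≥ 1)
  L (1+ zero) = β 1
  L (1+ (1+ n)) = β (2 ℕ.+ n) * K (1+ n) + L (1+ n)

module Submission where

-- The sums 𝓔[w] are computed by splitting off the FIRST block of a
-- marking: 𝓔[i ∷ w] = βᵢ·𝓔[w] + (pair weight)·𝓔[w minus 2 letters]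
-- + (quadruple weight)·𝓔[w minus 4 letters].
-- The recurrences for K and L, however, peel letters off at the END of
-- the words W n and W' n.  The core of the proof is therefore the
-- last-block expansion: for every prefix u,
--   E[u·ijkx] ≈ E[u·ijk]·βₓ + p(k,x)·E[u·ij] + q(i,j,k,x)·E[u],
-- proved by induction on u.  It only needs the weights p, q to be
-- central, which holds because they are even.  Specialised to W and W'
-- it yields the recurrences of E[W n] and E[W' n]; comparing them with
-- the recurrences of K and L (using that K is even, L is odd and
-- βᵢ² = 0) proves the theorem by induction on n.

open import Level using (_⊔_)
open import Defs
open import Data.Nat as ℕ using (ℕ; zero; _≥_; s≤s) renaming (suc to 1+)
open import Data.Nat.Properties using (1+n≢n)
open import Data.Product using (_×_; _,_)
open import Data.List using (List; []; _∷_; _++_; map; foldr)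
open import Data.List.Properties using (++-assoc)
open import Data.Sum using (inj₁; inj₂)
open import Data.Empty using (⊥-elim)
open import Relation.Nullary using (yes; no)
open import Relation.Binary.PropositionalEquality as P using (_≡_)
import Relation.Binary.Reasoning.Setoid as SetoidReasoning
import Algebra.Properties.CommutativeSemigroup as CommutativeSemigroupProperties
import Algebra.Properties.Ring as RingProperties

module SuperAlgebra {c ℓ} (R : SuperCommutativeRing c ℓ) where
  open SuperCommutativeRing R
  open SetoidReasoning setoid
  open CommutativeSemigroupProperties +-commutativeSemigroup using (interchange)

  Central : Carrier → Set (c ⊔ ℓ)
  Central z = ∀ x → z * x ≈ x * z

  -- Even elements are central: split x into its even and odd parts.
  even-central : ∀ {z} → Even z → Central z
  even-central {z} ez x with decompose x
  ... | e , o , ee , oo , x≈e+o = begin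
    z * x         ≈⟨ *-congˡ x≈e+o ⟩
    z * (e + o)   ≈⟨ distribˡ z e o ⟩
    z * e + z * o ≈⟨ +-cong (comm-Even-Even ez ee) (comm-Even-Odd ez oo) ⟩
    e * z + o * z ≈⟨ distribʳ z e o ⟨
    (e + o) * z   ≈⟨ *-congʳ x≈e+o ⟨
    x * z         ∎

  central-to-front : ∀ {z} → Central z → ∀ x y → x * (z * y) ≈ z * (x * y)
  central-to-front {z} cz x y = begin
    x * (z * y) ≈⟨ *-assoc x z y ⟨
    (x * z) * y ≈⟨ *-congʳ (cz x) ⟨
    (z * x) * y ≈⟨ *-assoc z x y ⟩
    z * (x * y) ∎

  -- Such representations add coefficientwise and
  -- are preserved by left multiplication, since p and q are central.
  module Expansion (b p q : Carrier) (p-central : Central p) (q-central : Central q) where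

    Expands : Carrier → Carrier → Carrier → Carrier → Set ℓ
    Expands X A B C = X ≈ A * b + (p * B + q * C)

    +-expands : ∀ {X A B C Y A′ B′ C′} → Expands X A B C → Expands Y A′ B′ C′
              → Expands (X + Y) (A + A′) (B + B′) (C + C′)
    +-expands {X} {A} {B} {C} {Y} {A′} {B′} {C′} hX hY = begin
      X + Y
        ≈⟨ +-cong hX hY ⟩
      (A * b + (p * B + q * C)) + (A′ * b + (p * B′ + q * C′))
        ≈⟨ interchange _ _ _ _ ⟩
      (A * b + A′ * b) + ((p * B + q * C) + (p * B′ + q * C′))
        ≈⟨ +-cong (distribʳ b A A′) (interchange _ _ _ _) ⟨
      (A + A′) * b + ((p * B + p * B′) + (q * C + q * C′))
        ≈⟨ +-congˡ (+-cong (distribˡ p B B′) (distribˡ q C C′)) ⟨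
      (A + A′) * b + (p * (B + B′) + q * (C + C′)) ∎

    *-expands : ∀ {X A B C} x → Expands X A B C → Expands (x * X) (x * A) (x * B) (x * C)
    *-expands {X} {A} {B} {C} x hX = begin
      x * X
        ≈⟨ *-congˡ hX ⟩
      x * (A * b + (p * B + q * C))
        ≈⟨ distribˡ x _ _ ⟩
      x * (A * b) + x * (p * B + q * C)
        ≈⟨ +-cong (*-assoc x A b) (sym (distribˡ x _ _)) ⟨
      x * A * b + (x * (p * B) + x * (q * C))
        ≈⟨ +-congˡ (+-cong (central-to-front p-central x B) (central-to-front q-central x C)) ⟩
      x * A * b + (p * (x * B) + q * (x * C)) ∎

    expands-cong : ∀ {X A B C A′ B′ C′} → A ≈ A′ → B ≈ B′ → C ≈ C′
                 → Expands X A B C → Expands X A′ B′ C′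
    expands-cong eA eB eC hX =
      trans hX (+-cong (*-congʳ eA) (+-cong (*-congˡ eB) (*-congˡ eC)))

    0-expands : Expands 0# 0# 0# 0#
    0-expands = sym (begin
      0# * b + (p * 0# + q * 0#) ≈⟨ +-cong (zeroˡ b) (+-cong (zeroʳ p) (zeroʳ q)) ⟩
      0# + (0# + 0#)             ≈⟨ +-identityˡ _ ⟩
      0# + 0#                    ≈⟨ +-identityˡ 0# ⟩
      0#                         ∎)

    b-expands : ∀ X → Expands (X * b) X 0# 0#
    b-expands X = sym (begin
      X * b + (p * 0# + q * 0#) ≈⟨ +-congˡ (+-cong (zeroʳ p) (zeroʳ q)) ⟩
      X * b + (0# + 0#)         ≈⟨ +-congˡ (+-identityˡ 0#) ⟩
      X * b + 0#                ≈⟨ +-identityʳ _ ⟩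
      X * b                     ∎)

    p-expands : ∀ X → Expands (p * X) 0# X 0#
    p-expands X = sym (begin
      0# * b + (p * X + q * 0#) ≈⟨ +-cong (zeroˡ b) (+-congˡ (zeroʳ q)) ⟩
      0# + (p * X + 0#)         ≈⟨ +-identityˡ _ ⟩
      p * X + 0#                ≈⟨ +-identityʳ _ ⟩
      p * X                     ∎)

    q-expands : ∀ X → Expands (q * X) 0# 0# X
    q-expands X = sym (begin
      0# * b + (p * 0# + q * X) ≈⟨ +-cong (zeroˡ b) (+-congʳ (zeroʳ p)) ⟩
      0# + (0# + q * X)         ≈⟨ +-identityˡ _ ⟩
      0# + q * X                ≈⟨ +-identityˡ _ ⟩
      q * X                     ∎)

module Proof {c ℓ} (R : SuperCommutativeRing c ℓ)
  (a β : ℕ → SuperCommutativeRing.Carrier R)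
  (a-even : ∀ i → SuperCommutativeRing.Even R (a i))
  (β-odd : ∀ i → SuperCommutativeRing.Odd R (β i)) where
  open SuperCommutativeRing R
  open SetoidReasoning setoid
  open SuperAlgebra R
  open RingProperties ring using (-1*x≈-x)

  pairWeight : ℕ → ℕ → Carrier
  pairWeight i j with j ℕ.≟ i
  ... | yes _ = a i
  ... | no _ with j ℕ.≟ 1+ i
  ...   | yes _ = 1#
  ...   | no _ = 0#

  quadWeight : ℕ → ℕ → ℕ → ℕ → Carrier
  quadWeight i j k l with j ℕ.≟ i | k ℕ.≟ 1+ i | l ℕ.≟ 1+ i
  ... | yes _ | yes _ | yes _ = - 1#
  ... | _     | _     | _     = 0#

  pairWeight-even : ∀ i j → Even (pairWeight i j)
  pairWeight-even i j with j ℕ.≟ i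
  ... | yes _ = a-even i
  ... | no _ with j ℕ.≟ 1+ i
  ...   | yes _ = Even-1
  ...   | no _ = Even-0

  quadWeight-even : ∀ i j k l → Even (quadWeight i j k l)
  quadWeight-even i j k l with j ℕ.≟ i | k ℕ.≟ 1+ i | l ℕ.≟ 1+ i
  ... | yes _ | yes _ | yes _ = Even-- Even-1
  ... | yes _ | yes _ | no _  = Even-0
  ... | yes _ | no _  | _     = Even-0
  ... | no _  | _     | _     = Even-0

  pairWeight-equal : ∀ i → pairWeight i i ≈ a i
  pairWeight-equal i with i ℕ.≟ i
  ... | yes _ = refl
  ... | no i≢i = ⊥-elim (i≢i P.refl)

  pairWeight-succ : ∀ i → pairWeight i (1+ i) ≈ 1#
  pairWeight-succ i with 1+ i ℕ.≟ i
  ... | yes 1+i≡i = ⊥-elim (1+n≢n 1+i≡i)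
  ... | no _ with 1+ i ℕ.≟ 1+ i
  ...   | yes _ = refl
  ...   | no ≢ = ⊥-elim (≢ P.refl)

  quadWeight-block : ∀ i → quadWeight i i (1+ i) (1+ i) ≈ - 1#
  quadWeight-block i with i ℕ.≟ i | 1+ i ℕ.≟ 1+ i | 1+ i ℕ.≟ 1+ i
  ... | yes _ | yes _ | yes _ = refl
  ... | yes _ | yes _ | no ≢  = ⊥-elim (≢ P.refl)
  ... | yes _ | no ≢  | _     = ⊥-elim (≢ P.refl)
  ... | no ≢  | _     | _     = ⊥-elim (≢ P.refl)

  quadWeight-step : ∀ i k l → quadWeight i (1+ i) k l ≈ 0#
  quadWeight-step i k l with 1+ i ℕ.≟ i | k ℕ.≟ 1+ i | l ℕ.≟ 1+ i
  ... | yes 1+i≡i | _ | _ = ⊥-elim (1+n≢n 1+i≡i)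
  ... | no _      | _ | _ = refl

  -- E w: the sum over markings of w, organised by the first block.
  -- E-pair y v collects the markings of y ∷ v starting with a pair or
  -- quadruple, E-quad y z v those of y ∷ z ∷ v starting with a quadruple.
  mutual
    E : List ℕ → Carrier
    E [] = 1#
    E (y ∷ v) = β y * E v + E-pair y v

    E-pair : ℕ → List ℕ → Carrier
    E-pair y [] = 0#
    E-pair y (z ∷ v) = pairWeight y z * E v + E-quad y z v

    E-quad : ℕ → ℕ → List ℕ → Carrier
    E-quad y z [] = 0#
    E-quad y z (w ∷ []) = 0#
    E-quad y z (w ∷ t ∷ v) = quadWeight y z w t * E v

  E-cong : ∀ {u v} → u ≡ v → E u ≈ E v
  E-cong u≡v = reflexive (P.cong E u≡v)

  total : ∀ {w} → List (Marking w) → Carrier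
  total ms = foldr _+_ 0# (map (monomial R a β) ms)

  total-++ : ∀ {w} (ms ns : List (Marking w)) → total (ms ++ ns) ≈ total ms + total ns
  total-++ [] ns = sym (+-identityˡ _)
  total-++ (m ∷ ms) ns = trans (+-congˡ (total-++ ms ns)) (sym (+-assoc _ _ _))

  total-map : ∀ {w w′} (f : Marking w → Marking w′) x
            → (∀ m → monomial R a β (f m) ≈ x * monomial R a β m)
            → ∀ ms → total (map f ms) ≈ x * total ms
  total-map f x hf [] = sym (zeroʳ x)
  total-map f x hf (m ∷ ms) =
    trans (+-cong (hf m) (total-map f x hf ms)) (sym (distribˡ x _ _))

  weights-even : ∀ {w} (m : Marking w) → Even (weights R a β m)
  weights-even done = Even-1
  weights-even (single m) = weights-even m
  weights-even (pair {i = i} (inj₁ _) m) = Even-*-Even (a-even i) (weights-even m)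
  weights-even (pair (inj₂ _) m) = Even-*-Even Even-1 (weights-even m)
  weights-even (quad _ _ _ m) = Even-*-Even (Even-- Even-1) (weights-even m)

  singlesFirst : ∀ i v → List (Marking (i ∷ v))
  singlesFirst i v = map single (markings v)

  pairsFirst : ∀ i j v → List (Marking (i ∷ j ∷ v))
  pairsFirst i j v = pairPart i j (markings v)

  -- A leading singleton contributes βᵢ in front; the weights being
  -- even, βᵢ commutes past them.
  total-singles : ∀ i v → total (markings v) ≈ E v
                → total (singlesFirst i v) ≈ β i * E v
  total-singles i v ih = trans (total-map single (β i) move (markings v)) (*-congˡ ih)
    where
    move : ∀ m → monomial R a β (single {i = i} m) ≈ β i * monomial R a β m
    move m = let w = weights R a β m ; s = singles R a β m in begin
      w * (β i * s) ≈⟨ central-to-front (even-central (weights-even m)) (β i) s ⟨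
      β i * (w * s) ∎

  total-pairs : ∀ i j v → total (markings v) ≈ E v
              → total (pairsFirst i j v) ≈ pairWeight i j * E v
  total-pairs i j v ih = trans (split (markings v)) (*-congˡ ih)
    where
    split : ∀ ms → total (pairPart i j ms) ≈ pairWeight i j * total ms
    split ms with j ℕ.≟ i
    ... | yes e = total-map (pair (inj₁ e)) (a i) (λ _ → *-assoc _ _ _) ms
    ... | no _ with j ℕ.≟ 1+ i
    ...   | yes e = total-map (pair (inj₂ e)) 1# (λ _ → *-assoc _ _ _) ms
    ...   | no _ = sym (zeroˡ _)

  total-quads : ∀ i j k l v → total (markings v) ≈ E v
              → total (quadPart i j k l (markings v)) ≈ quadWeight i j k l * E v
  total-quads i j k l v ih = trans (split (markings v)) (*-congˡ ih)
    where
    split : ∀ ms → total (quadPart i j k l ms) ≈ quadWeight i j k l * total ms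
    split ms with j ℕ.≟ i | k ℕ.≟ 1+ i | l ℕ.≟ 1+ i
    ... | yes e | yes f | yes g = total-map (quad e f g) (- 1#) (λ _ → *-assoc _ _ _) ms
    ... | yes _ | yes _ | no _  = sym (zeroˡ _)
    ... | yes _ | no _  | _     = sym (zeroˡ _)
    ... | no _  | _     | _     = sym (zeroˡ _)

  𝓔≈E : ∀ w → 𝓔 R a β w ≈ E w
  𝓔≈E [] = trans (+-identityʳ _) (*-identityʳ _)
  𝓔≈E (i ∷ []) = trans (total-singles i [] (𝓔≈E [])) (sym (+-identityʳ _))
  𝓔≈E (i ∷ j ∷ []) = trans (total-++ (singlesFirst i (j ∷ [])) (pairsFirst i j []))
    (+-cong (total-singles i (j ∷ []) (𝓔≈E (j ∷ [])))
            (trans (total-pairs i j [] (𝓔≈E [])) (sym (+-identityʳ _))))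
  𝓔≈E (i ∷ j ∷ k ∷ []) = trans (total-++ (singlesFirst i (j ∷ k ∷ [])) (pairsFirst i j (k ∷ [])))
    (+-cong (total-singles i (j ∷ k ∷ []) (𝓔≈E (j ∷ k ∷ [])))
            (trans (total-pairs i j (k ∷ []) (𝓔≈E (k ∷ []))) (sym (+-identityʳ _))))
  𝓔≈E (i ∷ j ∷ k ∷ l ∷ w) =
    trans (total-++ (singlesFirst i (j ∷ k ∷ l ∷ w))
                    (pairsFirst i j (k ∷ l ∷ w) ++ quadPart i j k l (markings w)))
    (+-cong (total-singles i (j ∷ k ∷ l ∷ w) (𝓔≈E (j ∷ k ∷ l ∷ w)))
            (trans (total-++ (pairsFirst i j (k ∷ l ∷ w)) (quadPart i j k l (markings w)))
                   (+-cong (total-pairs i j (k ∷ l ∷ w) (𝓔≈E (k ∷ l ∷ w)))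
                           (total-quads i j k l w (𝓔≈E w)))))

  -- Last-block expansion of a word ending in i j k x: the last block
  -- is the singleton x, the pair k x, or the quadruple i j k x.
  module LastBlock (i j k x : ℕ) where
    open Expansion (β x) (pairWeight k x) (quadWeight i j k x)
                   (even-central (pairWeight-even k x)) (even-central (quadWeight-even i j k x))

    last-of-1 : Expands (E (x ∷ [])) (E []) 0# 0#
    last-of-1 = trans (trans (+-identityʳ _) (trans (*-identityʳ _) (sym (*-identityˡ _))))
                      (b-expands 1#)

    last-of-2 : Expands (E (k ∷ x ∷ [])) (E (k ∷ [])) (E []) 0#
    last-of-2 =
      expands-cong (+-congˡ (+-identityʳ 0#))
                   (trans (+-cong (zeroʳ _) (+-identityʳ _)) (+-identityˡ _))
                   (trans (+-cong (zeroʳ _) (+-identityʳ 0#)) (+-identityˡ 0#))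
        (+-expands (*-expands (β k) last-of-1) (+-expands (p-expands (E [])) 0-expands))

    last-of-3 : Expands (E (j ∷ k ∷ x ∷ [])) (E (j ∷ k ∷ [])) (E (j ∷ [])) 0#
    last-of-3 =
      expands-cong refl
                   (+-congˡ (trans (+-identityʳ _) (zeroʳ _)))
                   (trans (+-cong (zeroʳ _) (trans (+-identityʳ _) (zeroʳ _))) (+-identityˡ 0#))
        (+-expands (*-expands (β j) last-of-2)
                   (+-expands (*-expands (pairWeight j k) last-of-1) 0-expands))

    mutual
      last-block : ∀ u → Expands (E (u ++ i ∷ j ∷ k ∷ x ∷ []))
                                 (E (u ++ i ∷ j ∷ k ∷ [])) (E (u ++ i ∷ j ∷ [])) (E u)
      last-block [] =
        expands-cong refl refl
                     (trans (+-cong (zeroʳ _) (+-congʳ (zeroʳ _)))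
                            (trans (+-identityˡ _) (+-identityˡ _)))
          (+-expands (*-expands (β i) last-of-3)
                     (+-expands (*-expands (pairWeight i j) last-of-2) (q-expands (E []))))
      last-block (y ∷ u) = +-expands (*-expands (β y) (last-block u)) (last-block-pair y u)

      last-block-pair : ∀ y u → Expands (E-pair y (u ++ i ∷ j ∷ k ∷ x ∷ []))
                                        (E-pair y (u ++ i ∷ j ∷ k ∷ []))
                                        (E-pair y (u ++ i ∷ j ∷ [])) (E-pair y u)
      last-block-pair y [] =
        expands-cong refl (+-congˡ (zeroʳ _))
                     (trans (+-cong (zeroʳ _) (zeroʳ _)) (+-identityˡ 0#))
          (+-expands (*-expands (pairWeight y i) last-of-3)
                     (*-expands (quadWeight y i j k) last-of-1))
      last-block-pair y (z ∷ u) =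
        +-expands (*-expands (pairWeight y z) (last-block u)) (last-block-quad y z u)

      last-block-quad : ∀ y z u → Expands (E-quad y z (u ++ i ∷ j ∷ k ∷ x ∷ []))
                                          (E-quad y z (u ++ i ∷ j ∷ k ∷ []))
                                          (E-quad y z (u ++ i ∷ j ∷ [])) (E-quad y z u)
      last-block-quad y z [] =
        expands-cong refl refl (zeroʳ _) (*-expands (quadWeight y z i j) last-of-2)
      last-block-quad y z (w ∷ []) =
        expands-cong refl refl (zeroʳ _) (*-expands (quadWeight y z w i) last-of-3)
      last-block-quad y z (w ∷ t ∷ v) = *-expands (quadWeight y z w t) (last-block v)

  W-snoc : ∀ n v → W (1+ n) ++ v ≡ W n ++ (1+ n ∷ 1+ n ∷ v)
  W-snoc n v = ++-assoc (W n) (1+ n ∷ 1+ n ∷ []) v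

  W-via-W' : ∀ n v → W (1+ n) ++ v ≡ W' (1+ n) ++ (1+ n ∷ v)
  W-via-W' n v = P.trans (W-snoc n v) (P.sym (++-assoc (W n) (1+ n ∷ []) (1+ n ∷ v)))

  W-recurrence : ∀ n → E (W (2 ℕ.+ n)) ≈
    E (W' (2 ℕ.+ n)) * β (2 ℕ.+ n) + (a (2 ℕ.+ n) * E (W (1+ n)) + - 1# * E (W n))
  W-recurrence n = begin
    E (W (2 ℕ.+ n))
      ≡⟨ P.cong E (W-snoc n _) ⟩
    E (W n ++ 1+ n ∷ 1+ n ∷ 2 ℕ.+ n ∷ 2 ℕ.+ n ∷ [])
      ≈⟨ LastBlock.last-block (1+ n) (1+ n) (2 ℕ.+ n) (2 ℕ.+ n) (W n) ⟩
    E (W n ++ 1+ n ∷ 1+ n ∷ 2 ℕ.+ n ∷ [])  * β (2 ℕ.+ n)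
      + (pairWeight (2 ℕ.+ n) (2 ℕ.+ n) * E (W (1+ n))
         + quadWeight (1+ n) (1+ n) (2 ℕ.+ n) (2 ℕ.+ n) * E (W n))
      ≈⟨ +-cong (sym (*-congʳ (E-cong (W-snoc n _))))
                (+-cong (*-congʳ (pairWeight-equal (2 ℕ.+ n))) (*-congʳ (quadWeight-block (1+ n)))) ⟩
    E (W' (2 ℕ.+ n)) * β (2 ℕ.+ n) + (a (2 ℕ.+ n) * E (W (1+ n)) + - 1# * E (W n)) ∎

  W'-recurrence : ∀ n → E (W' (2 ℕ.+ n)) ≈ E (W (1+ n)) * β (2 ℕ.+ n) + E (W' (1+ n))
  W'-recurrence zero = begin
    E (W' 2)
      ≈⟨ LastBlock.last-of-3 0 1 1 2 ⟩
    E (W 1) * β 2 + (pairWeight 1 2 * E (W' 1) + quadWeight 0 1 1 2 * 0#)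
      ≈⟨ +-congˡ (+-cong (trans (*-congʳ (pairWeight-succ 1)) (*-identityˡ _)) (zeroʳ _)) ⟩
    E (W 1) * β 2 + (E (W' 1) + 0#)
      ≈⟨ +-congˡ (+-identityʳ _) ⟩
    E (W 1) * β 2 + E (W' 1) ∎
  W'-recurrence (1+ m) = begin
    E (W' (3 ℕ.+ m))
      ≡⟨ P.cong E (P.trans (++-assoc (W (1+ m)) (2 ℕ.+ m ∷ 2 ℕ.+ m ∷ []) (3 ℕ.+ m ∷ []))
                           (W-via-W' m _)) ⟩
    E (W' (1+ m) ++ 1+ m ∷ 2 ℕ.+ m ∷ 2 ℕ.+ m ∷ 3 ℕ.+ m ∷ [])
      ≈⟨ LastBlock.last-block (1+ m) (2 ℕ.+ m) (2 ℕ.+ m) (3 ℕ.+ m) (W' (1+ m)) ⟩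
    E (W' (1+ m) ++ 1+ m ∷ 2 ℕ.+ m ∷ 2 ℕ.+ m ∷ []) * β (3 ℕ.+ m)
      + (pairWeight (2 ℕ.+ m) (3 ℕ.+ m) * E (W' (1+ m) ++ 1+ m ∷ 2 ℕ.+ m ∷ [])
         + quadWeight (1+ m) (2 ℕ.+ m) (2 ℕ.+ m) (3 ℕ.+ m) * E (W' (1+ m)))
      ≈⟨ +-cong (sym (*-congʳ (E-cong (W-via-W' m _))))
                (+-cong (*-cong (pairWeight-succ (2 ℕ.+ m)) (E-cong (P.sym (W-via-W' m _))))
                        (*-congʳ (quadWeight-step (1+ m) _ _))) ⟩
    E (W (2 ℕ.+ m)) * β (3 ℕ.+ m) + (1# * E (W' (2 ℕ.+ m)) + 0# * E (W' (1+ m)))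
      ≈⟨ +-congˡ (trans (+-cong (*-identityˡ _) (zeroˡ _)) (+-identityʳ _)) ⟩
    E (W (2 ℕ.+ m)) * β (3 ℕ.+ m) + E (W' (2 ℕ.+ m)) ∎

  mutual
    K-even : ∀ n → Even (K R a β n)
    K-even zero = Even-1
    K-even (1+ zero) = a-even 1
    K-even (1+ (1+ n)) =
      Even-+ (Even-+ (Even-*-Even (a-even _) (K-even (1+ n))) (Even-- (K-even n)))
             (Even-- (Odd-*-Odd (β-odd _) (L-odd (1+ n))))

    L-odd : ∀ n → Odd (L R a β n)
    L-odd zero = Odd-0
    L-odd (1+ zero) = β-odd 1
    L-odd (1+ (1+ n)) = Odd-+ (Odd-*-Even (β-odd _) (K-even (1+ n))) (L-odd (1+ n))

  -- L_{n+2}·β_{n+2} ≈ −β_{n+2}·L_{n+1}, since β_{n+2}² = 0 and K is central.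
  L-times-β : ∀ n → L R a β (2 ℕ.+ n) * β (2 ℕ.+ n) ≈ - (β (2 ℕ.+ n) * L R a β (1+ n))
  L-times-β n = begin
    (b * K₁ + L₁) * b     ≈⟨ distribʳ b (b * K₁) L₁ ⟩
    (b * K₁) * b + L₁ * b ≈⟨ +-congʳ (*-assoc b K₁ b) ⟩
    b * (K₁ * b) + L₁ * b ≈⟨ +-congʳ (*-congˡ (even-central (K-even (1+ n)) b)) ⟩
    b * (b * K₁) + L₁ * b ≈⟨ +-congʳ (*-assoc b b K₁) ⟨
    (b * b) * K₁ + L₁ * b ≈⟨ +-cong (trans (*-congʳ (square-Odd (β-odd _))) (zeroˡ K₁))
                                   (comm-Odd-Odd (L-odd (1+ n)) (β-odd _)) ⟩
    0# + - (b * L₁)       ≈⟨ +-identityˡ _ ⟩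
    - (b * L₁)            ∎
    where
    b = β (2 ℕ.+ n)
    K₁ = K R a β (1+ n)
    L₁ = L R a β (1+ n)

  -- Induction on n, carrying two consecutive values of K.
  K-L≈E : ∀ n → K R a β n ≈ E (W n) × K R a β (1+ n) ≈ E (W (1+ n))
                × L R a β (1+ n) ≈ E (W' (1+ n))
  K-L≈E zero = refl , K₁≈E , sym (trans (+-identityʳ _) (*-identityʳ _))
    where
    -- the markings of β₁β₁ are the pair (weight a₁) and two singletons (β₁² = 0)
    K₁≈E : a 1 ≈ β 1 * (β 1 * 1# + 0#) + (a 1 * 1# + 0#)
    K₁≈E = sym (begin
      β 1 * (β 1 * 1# + 0#) + (a 1 * 1# + 0#)
        ≈⟨ +-cong (*-congˡ (trans (+-identityʳ _) (*-identityʳ _)))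
                  (trans (+-identityʳ _) (*-identityʳ _)) ⟩
      β 1 * β 1 + a 1 ≈⟨ +-congʳ (square-Odd (β-odd 1)) ⟩
      0# + a 1        ≈⟨ +-identityˡ _ ⟩
      a 1             ∎)
  K-L≈E (1+ n) with K-L≈E n
  ... | K₀≈ , K₁≈ , L₁≈ = K₁≈ , K₂≈ , L₂≈
    where
    b = β (2 ℕ.+ n)
    L₂≈ : L R a β (2 ℕ.+ n) ≈ E (W' (2 ℕ.+ n))
    L₂≈ = begin
      b * K R a β (1+ n) + L R a β (1+ n) ≈⟨ +-congʳ (even-central (K-even (1+ n)) b) ⟨
      K R a β (1+ n) * b + L R a β (1+ n) ≈⟨ +-cong (*-congʳ K₁≈) L₁≈ ⟩
      E (W (1+ n)) * b + E (W' (1+ n))   ≈⟨ W'-recurrence n ⟨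
      E (W' (2 ℕ.+ n))                   ∎
    K₂≈ : K R a β (2 ℕ.+ n) ≈ E (W (2 ℕ.+ n))
    K₂≈ = sym (begin
      E (W (2 ℕ.+ n))
        ≈⟨ W-recurrence n ⟩
      E (W' (2 ℕ.+ n)) * b + (a (2 ℕ.+ n) * E (W (1+ n)) + - 1# * E (W n))
        ≈⟨ +-cong (*-congʳ L₂≈) (+-cong (*-congˡ K₁≈) (*-congˡ K₀≈)) ⟨
      L R a β (2 ℕ.+ n) * b + (a (2 ℕ.+ n) * K R a β (1+ n) + - 1# * K R a β n)
        ≈⟨ +-cong (L-times-β n) (+-congˡ (-1*x≈-x _)) ⟩
      - (b * L R a β (1+ n)) + (a (2 ℕ.+ n) * K R a β (1+ n) + - K R a β n)
        ≈⟨ +-comm _ _ ⟩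
      a (2 ℕ.+ n) * K R a β (1+ n) + - K R a β n + - (b * L R a β (1+ n)) ∎)

theorem1 : ∀ {c ℓ} (R : SuperCommutativeRing c ℓ)
    (a β : ℕ → SuperCommutativeRing.Carrier R) →
    (∀ i → SuperCommutativeRing.Even R (a i)) →
    (∀ i → SuperCommutativeRing.Odd R (β i)) →
    ∀ n → n ≥ 1 →
    SuperCommutativeRing._≈_ R (K R a β n) (𝓔 R a β (W n)) ×
    SuperCommutativeRing._≈_ R (L R a β n) (𝓔 R a β (W' n))
theorem1 R a β a-even β-odd (1+ m) (s≤s _) =
  let (_ , K≈E , L≈E) = K-L≈E m
  in trans K≈E (sym (𝓔≈E (W (1+ m)))) , trans L≈E (sym (𝓔≈E (W' (1+ m))))
  where
  open SuperCommutativeRing R using (trans; sym)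
  open Proof R a β a-even β-odd using (K-L≈E; 𝓔≈E)
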